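{- Let $A$ be a finite set of atoms and $P,R$ propositional Horn theories over $A$ such that $P$ does not depend on $R$ (i.e. $body(P)\cap head(R)=\emptyset$). Then $$P\cup R=cl_{head(R)}(P)\circ cl_{body(P)}(R)\quad\text{and}\quad cl_A(P\cup R)=cl_A(P)\circ cl_A(R).$$ Moreover, for any sets of atoms $B,C\subseteq A$ and any theory $P$, $cl_B(cl_C(P))=cl_{B\cup C}(P)$.
   Context: A theory over $A$ is a finite set of rules $a_0\leftarrow a_1,\ldots,a_k$ ($k\ge0$, $a_i\in A$), with $head(r)=\{a_0\}$, $body(r)=\{a_1,\ldots,a_k\}$, size $k$; $head(S),body(S)$ are unions over a set $S$ of rules. Write $S\subseteq_r R$ if $S\subseteq R$ has as many elements as the size of $r$. Composition: $P\circ R=\{head(r)\leftarrow body(S)\mid r\in P,\ S\subseteq_r R,\ head(S)=body(r)\}$. For $B\subseteq A$, $1_B=\{a\leftarrow a\mid a\in B\}$ and $cl_B(P)=1_B\cup P$. -}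

module Defs where

open import Level using (0ℓ)
open import Data.Nat using (ℕ)
open import Data.Fin using (Fin)
open import Data.Fin.Subset using (Subset; _∈_; ⁅_⁆; ∣_∣) renaming (_∪_ to _∪ˢ_; ⊥ to ∅ˢ)
open import Data.List using (List; length; map; foldr)
open import Data.List.Relation.Unary.Any using (Any)
open import Data.List.Relation.Unary.All using (All)
open import Data.List.Relation.Unary.Unique.Propositional using (Unique)
open import Data.Product using (Σ; ∃; _×_; _,_)
open import Data.Sum using (_⊎_)
open import Data.Empty using (⊥)
open import Relation.Binary.PropositionalEquality using (_≡_)
open import Function.Bundles using (_⇔_)

-- Atoms: the finite set A is Fin n.
-- A rule  a₀ ← a₁,…,aₖ  has a head atom and a (finite) set of body atoms.
record Rule (n : ℕ) : Set where
  constructor _←_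
  field
    hd : Fin n
    bd : Subset n
open Rule public

size : ∀ {n} → Rule n → ℕ
size r = ∣ bd r ∣

-- A theory over A: a set of rules over A (as a predicate; every such set is finite
-- since there are finitely many rules over Fin n).
Theory : ℕ → Set₁
Theory n = Rule n → Set

AtomSet : ℕ → Set₁
AtomSet n = Fin n → Set

_≐_ : ∀ {n} → Theory n → Theory n → Set
P ≐ Q = ∀ r → (P r ⇔ Q r)
infix 4 _≐_

_∪ᵀ_ : ∀ {n} → Theory n → Theory n → Theory n
(P ∪ᵀ Q) r = P r ⊎ Q r
infixr 6 _∪ᵀ_

_∪ᴬ_ : ∀ {n} → AtomSet n → AtomSet n → AtomSet n
(B ∪ᴬ C) a = B a ⊎ C a

Atoms : ∀ {n} → AtomSet n
Atoms _ = Data.Unit.⊤ where import Data.Unit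

headT : ∀ {n} → Theory n → AtomSet n
headT R a = Σ (Rule _) λ r → R r × hd r ≡ a

bodyT : ∀ {n} → Theory n → AtomSet n
bodyT R a = Σ (Rule _) λ r → R r × a ∈ bd r

headL : ∀ {n} → List (Rule n) → AtomSet n
headL S a = Any (λ s → hd s ≡ a) S

bodyL : ∀ {n} → List (Rule n) → Subset n
bodyL S = foldr _∪ˢ_ ∅ˢ (map bd S)

_⊆[_]_ : ∀ {n} → List (Rule n) → Rule n → Theory n → Set
S ⊆[ r ] R = Unique S × All R S × length S ≡ size r

_∘ᵀ_ : ∀ {n} → Theory n → Theory n → Theory n
(P ∘ᵀ R) t = Σ (Rule _) λ r → Σ (List (Rule _)) λ S →
  P r × S ⊆[ r ] R × (∀ a → headL S a ⇔ (a ∈ bd r))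
  × hd t ≡ hd r × bd t ≡ bodyL S
infixr 7 _∘ᵀ_

id[_] : ∀ {n} → AtomSet n → Theory n
id[ B ] r = B (hd r) × bd r ≡ ⁅ hd r ⁆

cl : ∀ {n} → AtomSet n → Theory n → Theory n
cl B P = id[ B ] ∪ᵀ P

Indep : ∀ {n} → Theory n → Theory n → Set
Indep P R = ∀ a → bodyT P a → headT R a → ⊥

-- In a composite cl_X(P) ∘ cl_Y(R), a left rule r ∈ P can only be fed by identity rules,
-- because no body atom of P is the head of a rule of R; the composite is then r itself.
-- A left identity rule a ← a is fed by exactly one rule of cl_Y(R), which is the composite.
-- Conversely a rule of P is the composite of itself with the identities on its body, and
-- a rule of R the composite of the identity on its head with itself.
module Submission where

open import Defs
open import Data.Nat using (ℕ)
open import Data.Product using (Σ; _×_; _,_)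

open import Data.Bool using (true; false)
open import Data.Fin using (Fin; zero; suc)
open import Data.Fin.Properties using (suc-injective)
open import Data.Fin.Subset using (Subset; _∈_; ⁅_⁆; ∣_∣; ⋃)
open import Data.Fin.Subset.Properties
  using (x∈⁅y⁆⇔x≡y; x∈⁅x⁆; ∣⁅x⁆∣≡1; ⊆-antisym; x∈p∪q⁻; x∈p∪q⁺; ∉⊥; ∪-identityʳ)
open import Data.Vec using ([]; _∷_; here; there)
open import Data.List using (List; []; _∷_; [_]; length; map)
open import Data.List.Properties using (length-map; map-cong-local)
open import Data.List.Membership.Propositional using () renaming (_∈_ to _∈ᴸ_)
open import Data.List.Membership.Propositional.Properties using (∈-map⁺; ∈-map⁻)
open import Data.List.Relation.Unary.Any using (Any; here; there)
import Data.List.Relation.Unary.Any as Any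
import Data.List.Relation.Unary.Any.Properties as Anyₚ
open import Data.List.Relation.Unary.All using (All; []; _∷_)
import Data.List.Relation.Unary.All as All
import Data.List.Relation.Unary.All.Properties as Allₚ
open import Data.List.Relation.Unary.AllPairs using ([]; _∷_)
open import Data.List.Relation.Unary.Unique.Propositional using (Unique)
import Data.List.Relation.Unary.Unique.Propositional.Properties as Uniqueₚ
open import Data.Sum using (_⊎_; inj₁; inj₂; [_,_]′)
open import Data.Empty using (⊥-elim)
open import Data.Unit using (tt)
open import Function using (_∘_)
open import Relation.Binary.PropositionalEquality using (_≡_; refl; sym; trans; cong; subst)
open import Function.Bundles using (_⇔_; mk⇔; Equivalence)
open Equivalence

private
  variable
    n : ℕ
    x : Fin n
    p : Subset n
    r t : Rule n
    S : List (Rule n)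
    X Y : AtomSet n
    L P Q R : Theory n

Rule-≡ : hd t ≡ hd r → bd t ≡ bd r → t ≡ r
Rule-≡ {t = _ ← _} {_ ← _} refl refl = refl

idRule : Fin n → Rule n
idRule a = a ← ⁅ a ⁆

IsIdRule : Rule n → Set
IsIdRule s = bd s ≡ ⁅ hd s ⁆

elements : Subset n → List (Fin n)
elements []          = []
elements (true ∷ p)  = zero ∷ map suc (elements p)
elements (false ∷ p) = map suc (elements p)

∈-elements⁺ : x ∈ p → x ∈ᴸ elements p
∈-elements⁺ {p = true ∷ p}  here      = here refl
∈-elements⁺ {p = true ∷ p}  (there m) = there (∈-map⁺ suc (∈-elements⁺ m))
∈-elements⁺ {p = false ∷ p} (there m) = ∈-map⁺ suc (∈-elements⁺ m)

∈-elements⁻ : x ∈ᴸ elements p → x ∈ p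
∈-elements⁻ {p = true ∷ p} (here refl) = here
∈-elements⁻ {p = true ∷ p} (there m) with ∈-map⁻ suc m
... | _ , m′ , refl = there (∈-elements⁻ m′)
∈-elements⁻ {p = false ∷ p} m with ∈-map⁻ suc m
... | _ , m′ , refl = there (∈-elements⁻ m′)

elements-unique : (p : Subset n) → Unique (elements p)
elements-unique []          = []
elements-unique (true ∷ p)  =
  Allₚ.map⁺ (All.universal (λ _ ()) (elements p)) ∷ Uniqueₚ.map⁺ suc-injective (elements-unique p)
elements-unique (false ∷ p) = Uniqueₚ.map⁺ suc-injective (elements-unique p)

length-elements : (p : Subset n) → length (elements p) ≡ ∣ p ∣
length-elements []          = refl
length-elements (true ∷ p)  = cong ℕ.suc (trans (length-map suc (elements p)) (length-elements p))
length-elements (false ∷ p) = trans (length-map suc (elements p)) (length-elements p)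

∈-⋃⁻ : (ps : List (Subset n)) → x ∈ ⋃ ps → Any (x ∈_) ps
∈-⋃⁻ []       m = ⊥-elim (∉⊥ m)
∈-⋃⁻ (p ∷ ps) m = [ here , there ∘ ∈-⋃⁻ ps ]′ (x∈p∪q⁻ p (⋃ ps) m)

∈-⋃⁺ : {ps : List (Subset n)} → Any (x ∈_) ps → x ∈ ⋃ ps
∈-⋃⁺ (here m)  = x∈p∪q⁺ (inj₁ m)
∈-⋃⁺ (there m) = x∈p∪q⁺ (inj₂ (∈-⋃⁺ m))

∈-bodyL-idRules : All IsIdRule S → x ∈ bodyL S ⇔ headL S x
∈-bodyL-idRules {S = S} {x = x} ids rewrite map-cong-local ids = mk⇔
  (Any.map (sym ∘ to x∈⁅y⁆⇔x≡y) ∘ Anyₚ.map⁻ ∘ ∈-⋃⁻ (map (⁅_⁆ ∘ hd) S))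
  (∈-⋃⁺ ∘ Anyₚ.map⁺ ∘ Any.map (from x∈⁅y⁆⇔x≡y ∘ sym))

bodyL-idRules : All IsIdRule S → (∀ a → headL S a ⇔ a ∈ p) → bodyL S ≡ p
bodyL-idRules ids heads = ⊆-antisym
  (to (heads _) ∘ to (∈-bodyL-idRules ids))
  (from (∈-bodyL-idRules ids) ∘ from (heads _))

length≡1⇒singleton : length S ≡ 1 → Σ (Rule n) λ s → S ≡ [ s ]
length≡1⇒singleton {S = s ∷ []} refl = s , refl

∘-idRuleˡ : IsIdRule r → S ⊆[ r ] Q → (∀ a → headL S a ⇔ a ∈ bd r)
          → hd t ≡ hd r → bd t ≡ bodyL S → Q t
∘-idRuleˡ {r = r} {S = S} {Q = Q} isId (_ , Qs , len) heads ht bt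
  with length≡1⇒singleton {S = S} (trans len (trans (cong ∣_∣ isId) (∣⁅x⁆∣≡1 (hd r))))
... | s , refl with Qs | from (heads (hd r)) (subst (hd r ∈_) (sym isId) (x∈⁅x⁆ (hd r)))
...   | Q-s ∷ [] | here hs =
  subst Q (sym (Rule-≡ (trans ht (sym hs)) (trans bt (∪-identityʳ (bd s))))) Q-s

∘-idRulesʳ : All IsIdRule S → (∀ a → headL S a ⇔ a ∈ bd r)
           → hd t ≡ hd r → bd t ≡ bodyL S → t ≡ r
∘-idRulesʳ ids heads ht bt = Rule-≡ ht (trans bt (bodyL-idRules ids heads))

indep⇒idRules : Indep P R → P r → (∀ a → headL S a → a ∈ bd r) → All (cl Y R) S → All IsIdRule S
indep⇒idRules ind Pr heads []                  = []
indep⇒idRules ind Pr heads (inj₁ (_ , isId) ∷ cls) =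
  isId ∷ indep⇒idRules ind Pr (λ a → heads a ∘ there) cls
indep⇒idRules {r = r} ind Pr heads (inj₂ Rs ∷ _) =
  ⊥-elim (ind _ (r , Pr , heads _ (here refl)) (_ , Rs , refl))

∘-cl⁻ : Indep P R → (cl X P ∘ᵀ cl Y R) t → P t ⊎ (X (hd t) × cl Y R t)
∘-cl⁻ {P = P} ind (r , S , inj₂ Pr , (_ , cls , _) , heads , ht , bt) =
  inj₁ (subst P (sym (∘-idRulesʳ (indep⇒idRules ind Pr (λ a → to (heads a)) cls) heads ht bt)) Pr)
∘-cl⁻ {X = X} ind (r , S , inj₁ (Xr , isId) , sub , heads , ht , bt) =
  inj₂ (subst X (sym ht) Xr , ∘-idRuleˡ isId sub heads ht bt)

∘-cl-introʳ : L t → (∀ a → a ∈ bd t → X a) → (L ∘ᵀ cl X Q) t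
∘-cl-introʳ {t = t} {X = X} {Q = Q} Lt inX =
  t , idRules , Lt , (unique , cls , len) , heads , refl , sym (bodyL-idRules ids heads)
  where
  idRules : List (Rule _)
  idRules = map idRule (elements (bd t))

  heads : ∀ a → headL idRules a ⇔ a ∈ bd t
  heads a = mk⇔ (∈-elements⁻ ∘ Any.map sym ∘ Anyₚ.map⁻) (Anyₚ.map⁺ ∘ Any.map sym ∘ ∈-elements⁺)

  unique : Unique idRules
  unique = Uniqueₚ.map⁺ (cong hd) (elements-unique (bd t))

  cls : All (cl X Q) idRules
  cls = Allₚ.map⁺ (All.tabulate λ m → inj₁ (inX _ (∈-elements⁻ m) , refl))

  len : length idRules ≡ size t
  len = trans (length-map idRule (elements (bd t))) (length-elements (bd t))

  ids : All IsIdRule idRules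
  ids = Allₚ.map⁺ (All.universal (λ _ → refl) (elements (bd t)))

∘-cl-introˡ : X (hd t) → Q t → (cl X L ∘ᵀ Q) t
∘-cl-introˡ {t = t} Xt Qt =
  idRule (hd t) , [ t ] , inj₁ (Xt , refl) , ([] ∷ [] , Qt ∷ [] , sym (∣⁅x⁆∣≡1 (hd t)))
  , heads , refl , sym (∪-identityʳ (bd t))
  where
  heads : ∀ a → headL [ t ] a ⇔ a ∈ ⁅ hd t ⁆
  heads a = mk⇔ (λ { (here refl) → x∈⁅x⁆ (hd t) }) (here ∘ sym ∘ to x∈⁅y⁆⇔x≡y)

∪≐cl∘cl : Indep P R → P ∪ᵀ R ≐ cl (headT R) P ∘ᵀ cl (bodyT P) R
∪≐cl∘cl ind t = mk⇔
  [ (λ Pt → ∘-cl-introʳ (inj₂ Pt) (λ _ m → t , Pt , m))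
  , (λ Rt → ∘-cl-introˡ (t , Rt , refl) (inj₂ Rt)) ]′
  (λ c → [ inj₁ , (λ { (_ , inj₂ Rt) → inj₂ Rt
                     ; (inHeadR , inj₁ (inBodyP , _)) → ⊥-elim (ind _ inBodyP inHeadR) }) ]′
           (∘-cl⁻ ind c))

cl-Atoms-∪≐cl∘cl : Indep P R → cl Atoms (P ∪ᵀ R) ≐ cl Atoms P ∘ᵀ cl Atoms R
cl-Atoms-∪≐cl∘cl ind t = mk⇔
  [ (λ isId → ∘-cl-introˡ tt (inj₁ isId))
  , [ (λ Pt → ∘-cl-introʳ (inj₂ Pt) (λ _ _ → tt))
    , (λ Rt → ∘-cl-introˡ tt (inj₂ Rt)) ]′ ]′
  (λ c → [ inj₂ ∘ inj₁ , (λ { (_ , inj₁ isId) → inj₁ isId ; (_ , inj₂ Rt) → inj₂ (inj₂ Rt) }) ]′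
           (∘-cl⁻ ind c))

cl-cl≐cl-∪ : (B C : AtomSet n) (P : Theory n) → cl B (cl C P) ≐ cl (B ∪ᴬ C) P
cl-cl≐cl-∪ B C P r = mk⇔
  (λ { (inj₁ (b , e)) → inj₁ (inj₁ b , e)
     ; (inj₂ (inj₁ (c , e))) → inj₁ (inj₂ c , e)
     ; (inj₂ (inj₂ Pr)) → inj₂ Pr })
  (λ { (inj₁ (inj₁ b , e)) → inj₁ (b , e)
     ; (inj₁ (inj₂ c , e)) → inj₂ (inj₁ (c , e))
     ; (inj₂ Pr) → inj₂ (inj₂ Pr) })

lemma5p3 : (n : ℕ)
    → ((P R : Theory n) → Indep P R
        → (P ∪ᵀ R ≐ cl (headT R) P ∘ᵀ cl (bodyT P) R)
          × (cl Atoms (P ∪ᵀ R) ≐ cl Atoms P ∘ᵀ cl Atoms R))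
      × ((B C : AtomSet n) (P : Theory n) → cl B (cl C P) ≐ cl (B ∪ᴬ C) P)
lemma5p3 n = (λ P R ind → ∪≐cl∘cl ind , cl-Atoms-∪≐cl∘cl ind) , cl-cl≐cl-∪
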